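{- Consider the procedure findNewPartners described below, run on a graph $G=(V,E)$ with injective edge ranking $\pi$ and state $(P,k)$ as described. The vertices removed from the priority queue $S$ over the course of the procedure are removed in non-decreasing order of their priorities.
   Context: Setting: $G=(V,E)$ is a finite undirected graph, each edge $e$ has a rank $\pi(e)\in[0,1]$, and all ranks are distinct. A matching $\mathcal{M}$ is stored via, for each vertex $x$: $P(x)$, its matched partner ($P(x)=-1$ if $x$ is unmatched), and $k(x)$, the rank of the matching edge incident to $x$ ($k(x)=\infty$ if $x$ is unmatched). $S$ is a min-priority queue of (vertex, priority) pairs. Procedure findNewPartners$(S)$: while $S$ is nonempty: remove the pair $(v,r_v)$ of lowest priority from $S$; then scan the neighbors $w$ of $v$ with $r_v<\pi(v,w)<k(v)$ in increasing order of $\pi(v,w)$; for the first such $w$ with $\pi(v,w)<k(w)$ do: if $k(w)<\infty$, let $x=P(w)$, insert $(x,k(w))$ into $S$, and set $P(x)=-1$, $k(x)=\infty$; if $k(v)<\infty$, let $x=P(v)$, insert $(x,k(v))$ into $S$, and set $P(x)=-1$, $k(x)=\infty$; then set $P(v)=w$, $P(w)=v$, $k(v)=k(w)=\pi(v,w)$, and stop scanning, proceeding to the next iteration of the while-loop.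
   Formalization: The edge ranks π(e) are rational numbers in [0,1], and the priorities in S and the finite values of k(x) are likewise rational. -}

module Defs where

open import Data.Nat using (ℕ)
open import Data.Fin using (Fin; _≟_)
open import Data.Maybe using (Maybe; just; nothing)
open import Data.Product using (_×_; _,_)
open import Data.Sum using (_⊎_)
open import Data.List using (List; []; _∷_)
open import Data.List.Relation.Unary.All using (All)
open import Data.List.Relation.Binary.Permutation.Propositional using (_↭_)
open import Data.Rational using (ℚ; _<_; _≤_; 0ℚ; 1ℚ)
open import Data.Unit using (⊤)
open import Data.Empty using (⊥)
open import Relation.Nullary using (¬_; yes; no)
open import Relation.Binary.PropositionalEquality using (_≡_)

-- Ranks live in ℚ ∩ [0,1] (no reals in agda-stdlib).  k(x) takes values
-- in ℚ extended with ∞.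

data Ext : Set where
  fin : ℚ → Ext
  ∞   : Ext

_<ᵉ_ : Ext → Ext → Set
fin a <ᵉ fin b = a < b
fin a <ᵉ ∞     = ⊤
∞     <ᵉ _     = ⊥

record RankedGraph (n : ℕ) : Set₁ where
  field
    adj        : Fin n → Fin n → Set
    adj-sym    : ∀ {x y} → adj x y → adj y x
    adj-irrefl : ∀ {x} → ¬ adj x x
    π          : Fin n → Fin n → ℚ
    π-sym      : ∀ {x y} → adj x y → π x y ≡ π y x
    π-range    : ∀ {x y} → adj x y → (0ℚ ≤ π x y) × (π x y ≤ 1ℚ)
    π-inj      : ∀ {a b c d} → adj a b → adj c d → π a b ≡ π c d →
                 ((a ≡ c) × (b ≡ d)) ⊎ ((a ≡ d) × (b ≡ c))

-- Configuration: P (nothing = -1), k, and the priority queue S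
-- (a multiset of (vertex , priority) pairs, represented as a list).

record Config (n : ℕ) : Set where
  constructor config
  field
    P : Fin n → Maybe (Fin n)
    k : Fin n → Ext
    S : List (Fin n × ℚ)

open Config public

IsMatchingState : ∀ {n} → RankedGraph n → Config n → Set
IsMatchingState {n} G c =
  ∀ (x : Fin n) →
    ((P c x ≡ nothing) × (k c x ≡ ∞)) ⊎
    (∃y λ y → adj x y × (P c x ≡ just y) × (P c y ≡ just x) × (k c x ≡ fin (π x y)))
  where
    open RankedGraph G
    ∃y : (Fin n → Set) → Set
    ∃y B = Data.Product.Σ (Fin n) B

upd : ∀ {n} {A : Set} → (Fin n → A) → Fin n → A → Fin n → A
upd f x a y with x ≟ y
... | yes _ = a
... | no  _ = f y

unmatch : ∀ {n} → Config n → Fin n → Config n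
unmatch c x = config (upd (P c) x nothing) (upd (k c) x ∞) (S c)

evict : ∀ {n} → Config n → Fin n → Config n
evict c u with k c u | P c u
... | fin q | just x  = unmatch (config (P c) (k c) ((x , q) ∷ S c)) x
... | _     | _       = c

rematch : ∀ {n} → RankedGraph n → Config n → Fin n → Fin n → Config n
rematch G c v w =
  let c₁ = evict c w
      c₂ = evict c₁ v
      r  = RankedGraph.π G v w
  in config (upd (upd (P c₂) v (just w)) w (just v))
            (upd (upd (k c₂) v (fin r)) w (fin r))
            (S c₂)

Chosen : ∀ {n} → RankedGraph n → Config n → Fin n → ℚ → Fin n → Set
Chosen {n} G c v r w =
  adj v w × (r < π v w) × (fin (π v w) <ᵉ k c v) × (fin (π v w) <ᵉ k c w) ×
  (∀ (w' : Fin n) → adj v w' → r < π v w' → π v w' < π v w →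
     ¬ (fin (π v w') <ᵉ k c w'))
  where open RankedGraph G

data Step {n} (G : RankedGraph n) : Config n → ℚ → Config n → Set where
  noPartner : ∀ {c v r S'} →
    S c ↭ ((v , r) ∷ S') → All (λ p → r ≤ Data.Product.proj₂ p) S' →
    (∀ w → ¬ Chosen G c v r w) →
    Step G c r (config (P c) (k c) S')
  partner : ∀ {c v r S' w} →
    S c ↭ ((v , r) ∷ S') → All (λ p → r ≤ Data.Product.proj₂ p) S' →
    Chosen G c v r w →
    Step G c r (rematch G (config (P c) (k c) S') v w)

-- A (finite prefix of a) run of findNewPartners: the list of priorities of
-- the removed pairs, in order of removal.
data Exec {n} (G : RankedGraph n) : Config n → List ℚ → Config n → Set where
  done : ∀ {c} → Exec G c [] c
  step : ∀ {c c' c'' r rs} → Step G c r c' → Exec G c' rs c'' → Exec G c (r ∷ rs) c''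

-- When the pair (v , r) is removed, every pair still in S has priority ≥ r,
-- and the only pairs inserted during that iteration carry the old ranks k(w)
-- and k(v), which exceed π(v,w) > r because w was chosen with π(v,w) < k(w)
-- and π(v,w) < k(v).  So after each iteration all of S lies above the
-- priority just removed, and in particular so does the next one removed.
module Submission where

open import Defs
open import Data.List using (List; []; _∷_)
open import Data.Rational using (ℚ; _≤_; _<_)
open import Data.Rational.Properties using (<⇒≤; <-trans)
open import Data.List.Relation.Unary.Linked using (Linked; [-]; _∷_)
open import Data.List.Relation.Unary.All using (All; _∷_)
open import Data.List.Relation.Binary.Permutation.Propositional.Properties using (All-resp-↭)
open import Data.Product using (_,_; proj₂)
open import Data.Sum using (_⊎_; inj₁; inj₂)
open import Data.Maybe using (just; nothing)
open import Data.Fin using (Fin; _≟_)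
open import Relation.Nullary using (yes; no)
open import Relation.Binary.PropositionalEquality using (_≡_; refl; sym; trans)

_≼_ : ℚ → Ext → Set
r ≼ e = ∀ {q} → e ≡ fin q → r ≤ q

<-<ᵉ⇒≼ : ∀ {r p : ℚ} {e : Ext} → r < p → fin p <ᵉ e → r ≼ e
<-<ᵉ⇒≼ {e = fin _} r<p p<q refl = <⇒≤ (<-trans r<p p<q)

PrioritiesAbove : ℚ → ∀ {n} → Config n → Set
PrioritiesAbove r c = All (λ p → r ≤ proj₂ p) (S c)

upd-cases : ∀ {n} {A : Set} (f : Fin n → A) x a y → (upd f x a y ≡ f y) ⊎ (upd f x a y ≡ a)
upd-cases f x a y with x ≟ y
... | yes _ = inj₂ refl
... | no  _ = inj₁ refl

evict-k : ∀ {n} (c : Config n) u y → (k (evict c u) y ≡ k c y) ⊎ (k (evict c u) y ≡ ∞)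
evict-k c u y with k c u | P c u
... | fin _ | just x  = upd-cases (k c) x ∞ y
... | fin _ | nothing = inj₁ refl
... | ∞     | _       = inj₁ refl

evict-≼ : ∀ {n} {r} (c : Config n) u y → r ≼ k c y → r ≼ k (evict c u) y
evict-≼ c u y r≼ky eq with evict-k c u y
... | inj₁ same = r≼ky (trans (sym same) eq)
... | inj₂ inf  with () ← trans (sym inf) eq

evict-PrioritiesAbove : ∀ {n} {r} (c : Config n) u →
  PrioritiesAbove r c → r ≼ k c u → PrioritiesAbove r (evict c u)
evict-PrioritiesAbove c u above r≼ku with k c u | P c u
... | fin _ | just _  = r≼ku refl ∷ above
... | fin _ | nothing = above
... | ∞     | _       = above

Step-PrioritiesAbove : ∀ {n} {G : RankedGraph n} {c r c'} → Step G c r c' →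
  PrioritiesAbove r c'
Step-PrioritiesAbove (noPartner _ rest _) = rest
Step-PrioritiesAbove (partner {c = c} {v = v} {S' = S'} {w = w} _ rest (_ , r<π , π<kv , π<kw , _)) =
  evict-PrioritiesAbove c₁ v
    (evict-PrioritiesAbove c₀ w rest (<-<ᵉ⇒≼ r<π π<kw))
    (evict-≼ c₀ w v (<-<ᵉ⇒≼ r<π π<kv))
  where
    c₀ = config (P c) (k c) S'
    c₁ = evict c₀ w

Step-priority-≥ : ∀ {n} {G : RankedGraph n} {c r c' q} → Step G c r c' →
  PrioritiesAbove q c → q ≤ r
Step-priority-≥ (noPartner S↭ _ _) above with All-resp-↭ S↭ above
... | q≤r ∷ _ = q≤r
Step-priority-≥ (partner S↭ _ _) above with All-resp-↭ S↭ above
... | q≤r ∷ _ = q≤r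

Step-Exec-Linked : ∀ {n} {G : RankedGraph n} {c r c' rs c''} →
  Step G c r c' → Exec G c' rs c'' → Linked _≤_ (r ∷ rs)
Step-Exec-Linked s done          = [-]
Step-Exec-Linked s (step s' run) =
  Step-priority-≥ s' (Step-PrioritiesAbove s) ∷ Step-Exec-Linked s' run

claim2 : ∀ {n} (G : RankedGraph n) (c c' : Config n) (rs : List ℚ) →
         IsMatchingState G c → Exec G c rs c' → Linked _≤_ rs
claim2 G c c' .[] _ done       = Linked.[]
claim2 G c c' _   _ (step s run) = Step-Exec-Linked s run
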